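{- Let $G_3^*$ be the greedy set of positive integers free of three-term geometric progressions. Then the upper uniform density of $G_3^*$ equals its asymptotic density: $\overline{u}(G_3^*)=d(G_3^*)$.
   Context: A three-term geometric progression is a triple $a, na, n^2a$ with $a$ a positive integer and $n>1$ an integer. $G_3^*$ is built greedily: going through $1,2,3,\dots$ in order, each integer is included unless it is the largest term of a three-term geometric progression whose two smaller terms are already included. (Rankin showed that $G_3^*$ is exactly the set of positive integers $m$ such that for every prime $p$ dividing $m$, the exponent of $p$ in $m$ lies in $A_3^*$, the set of nonnegative integers having no digit $2$ in base $3$; its asymptotic density exists.) For $A\subseteq\mathbb{N}$, the asymptotic density is $d(A)=\lim_{N\to\infty}\frac{1}{N}\#(A\cap\{1,\dots,N\})$, and the upper uniform density is $\overline{u}(A)=\lim_{s\to\infty}\max_{n\ge 0}\frac{1}{s}\#\{a\in A: n<a\le n+s\}$. -}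

module Defs where

open import Data.Nat using (ℕ; zero; suc; _+_; _*_; _≤_)
open import Data.Bool using (Bool; true; false; if_then_else_)
open import Data.Integer using (+_)
open import Data.Rational using (ℚ; _/_; 0ℚ)
open import Data.Product using (_×_; ∃-syntax)
open import Relation.Nullary using (¬_)
open import Relation.Binary.PropositionalEquality using (_≡_)
open import Function.Bundles using (_⇔_)

GPEndingAt : (ℕ → Bool) → ℕ → Set
GPEndingAt g m = ∃[ a ] ∃[ r ] (1 ≤ a × 2 ≤ r × r * r * a ≡ m × g a ≡ true × g (r * a) ≡ true)

-- g is (the indicator of) the greedy set G₃*: 0 is not in it, and every
-- positive integer m is included iff it is NOT the largest term of a 3-term GP
-- whose two smaller terms (automatically < m) are already included.
-- By strong induction on m this determines g uniquely.
IsGreedyG3 : (ℕ → Bool) → Set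
IsGreedyG3 g = (g 0 ≡ false) × (∀ m → 1 ≤ m → (g m ≡ true ⇔ (¬ GPEndingAt g m)))

count : (ℕ → Bool) → ℕ → ℕ → ℕ
count g n zero = 0
count g n (suc s) = count g n s + (if g (n + suc s) then 1 else 0)

-- frac c s = c / s as a rational (with the harmless convention c/0 = 0)
frac : ℕ → ℕ → ℚ
frac c zero = 0ℚ
frac c (suc s) = (+ c) / suc s

-- Rankin's description of G₃*: m ∈ G₃* iff every exponent ν p m lies in A₃*, the
-- numbers without base-3 digit 2. Since A₃* has no three-term arithmetic
-- progression, the exponents of a progression a, r a, r² a at a prime p ∣ r rule out
-- all three terms being of this form. Conversely, an exponent e ∉ A₃* splits as
-- e = x + 2y with x, x + y ∈ A₃* and y > 0 (x drops the digits 2 of e, y keeps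
-- them as 1s); doing this at every prime writes m = z² w as the largest term of the
-- progression w, z w, z² w whose smaller terms lie in G₃*.
--
-- For the densities, sieve with the primes p ≤ P: keep m when each ν p m lies in
-- A₃* or is at least K. This periodic set, of period (P!)^K, contains G₃*, and the
-- excess consists of multiples of q^K with q ≤ P or of q² with q > P, of density at
-- most P / 2^K + 1 / P. All windows of a periodic set have nearly the same average,
-- so the same holds for G₃* up to the excess.

module Submission where

module TernaryDigits where

  open import Data.Bool using (Bool; true; false; _∧_; not; if_then_else_)
  open import Data.Empty using (⊥)
  open import Data.Nat
  open import Data.Nat.DivMod
  open import Data.Nat.Divisibility using (divides-refl)
  open import Data.Nat.Induction using (<-rec)
  open import Data.Nat.Properties
  open import Data.Nat.Tactic.RingSolver using (solve-∀)
  open import Data.Product using (_×_; _,_)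
  open import Relation.Binary.PropositionalEquality
  open import Relation.Nullary using (¬_)

  true≢false : true ≢ false
  true≢false ()

  foldDigits₃-fuel : {A : Set} → A → (ℕ → A → A) → ℕ → ℕ → A
  foldDigits₃-fuel z step zero    n       = z
  foldDigits₃-fuel z step (suc f) zero    = z
  foldDigits₃-fuel z step (suc f) (suc n) =
    step (suc n % 3) (foldDigits₃-fuel z step f (suc n / 3))

  foldDigits₃-fuel-irrelevant : {A : Set} (z : A) (step : ℕ → A → A) →
    ∀ f f′ n → n ≤ f → n ≤ f′ → foldDigits₃-fuel z step f n ≡ foldDigits₃-fuel z step f′ n
  foldDigits₃-fuel-irrelevant z step zero    zero     zero    _ _ = refl
  foldDigits₃-fuel-irrelevant z step zero    (suc f′) zero    _ _ = refl
  foldDigits₃-fuel-irrelevant z step (suc f) zero     zero    _ _ = refl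
  foldDigits₃-fuel-irrelevant z step (suc f) (suc f′) zero    _ _ = refl
  foldDigits₃-fuel-irrelevant z step (suc f) (suc f′) (suc n) (s≤s n≤f) (s≤s n≤f′) =
    cong (step (suc n % 3))
      (foldDigits₃-fuel-irrelevant z step f f′ (suc n / 3) (quotient≤ n≤f) (quotient≤ n≤f′))
    where
    quotient≤ : ∀ {f} → n ≤ f → suc n / 3 ≤ f
    quotient≤ n≤f = ≤-pred (≤-trans (m/n<m (suc n) 3 (s≤s (s≤s z≤n))) (s≤s n≤f))

  -- Right fold over the base-3 digits of n, least significant digit outermost.
  foldDigits₃ : {A : Set} → A → (ℕ → A → A) → ℕ → A
  foldDigits₃ z step n = foldDigits₃-fuel z step n n

  foldDigits₃-unfold : {A : Set} (z : A) (step : ℕ → A → A) → step 0 z ≡ z →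
    ∀ n → foldDigits₃ z step n ≡ step (n % 3) (foldDigits₃ z step (n / 3))
  foldDigits₃-unfold z step fix zero    = sym fix
  foldDigits₃-unfold z step fix (suc n) =
    cong (step (suc n % 3))
      (foldDigits₃-fuel-irrelevant z step n (suc n / 3) (suc n / 3)
        (≤-pred (m/n<m (suc n) 3 (s≤s (s≤s z≤n)))) ≤-refl)

  digit-remainder : ∀ {d} q → d < 3 → (d + q * 3) % 3 ≡ d
  digit-remainder {d} q d<3 = trans ([m+kn]%n≡m%n d q 3) (m<n⇒m%n≡m d<3)

  digit-quotient : ∀ {d} q → d < 3 → (d + q * 3) / 3 ≡ q
  digit-quotient {d} q d<3 =
    trans (+-distrib-/-∣ʳ d (divides-refl q)) (cong₂ _+_ (m<n⇒m/n≡0 d<3) (m*n/n≡m q 3))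

  foldDigits₃-digit : {A : Set} (z : A) (step : ℕ → A → A) → step 0 z ≡ z →
    ∀ {d} q → d < 3 → foldDigits₃ z step (d + q * 3) ≡ step d (foldDigits₃ z step q)
  foldDigits₃-digit z step fix {d} q d<3 =
    trans (foldDigits₃-unfold z step fix (d + q * 3))
          (cong₂ step (digit-remainder q d<3) (cong (foldDigits₃ z step) (digit-quotient q d<3)))

  ternary-ind : (P : ℕ → Set) → P 0 → (∀ {d} q → d < 3 → P q → P (d + q * 3)) → ∀ n → P n
  ternary-ind P P0 step = <-rec P go
    where
    go : ∀ n → (∀ {m} → m < n → P m) → P n
    go zero    _   = P0
    go (suc n) rec = subst P (sym (m≡m%n+[m/n]*n (suc n) 3))
      (step (suc n / 3) (m%n<n (suc n) 3) (rec (m/n<m (suc n) 3 (s≤s (s≤s z≤n)))))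

  noDigit2 : ℕ → Bool
  noDigit2 = foldDigits₃ true (λ d b → not (d ≡ᵇ 2) ∧ b)

  dropTwo : ℕ → ℕ
  dropTwo d = if d ≡ᵇ 2 then 0 else d

  isTwo : ℕ → ℕ
  isTwo d = if d ≡ᵇ 2 then 1 else 0

  dropTwos : ℕ → ℕ
  dropTwos = foldDigits₃ 0 (λ d x → dropTwo d + x * 3)

  twos : ℕ → ℕ
  twos = foldDigits₃ 0 (λ d y → isTwo d + y * 3)

  noDigit2-digit : ∀ {d} q → d < 3 → noDigit2 (d + q * 3) ≡ not (d ≡ᵇ 2) ∧ noDigit2 q
  noDigit2-digit = foldDigits₃-digit true (λ d b → not (d ≡ᵇ 2) ∧ b) refl

  noDigit2-small : ∀ {d} q → d < 2 → noDigit2 (d + q * 3) ≡ noDigit2 q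
  noDigit2-small {0} q _ = noDigit2-digit q (s≤s z≤n)
  noDigit2-small {1} q _ = noDigit2-digit q (s≤s (s≤s z≤n))
  noDigit2-small {suc (suc _)} q (s≤s (s≤s ()))

  noDigit2-digit2 : ∀ q → noDigit2 (2 + q * 3) ≡ false
  noDigit2-digit2 q = noDigit2-digit q (s≤s (s≤s (s≤s z≤n)))

  digit2∉noDigit2 : ∀ q → noDigit2 (2 + q * 3) ≢ true
  digit2∉noDigit2 q h = true≢false (trans (sym h) (noDigit2-digit2 q))

  dropTwos-digit : ∀ {d} q → d < 3 → dropTwos (d + q * 3) ≡ dropTwo d + dropTwos q * 3
  dropTwos-digit = foldDigits₃-digit 0 (λ d x → dropTwo d + x * 3) refl

  twos-digit : ∀ {d} q → d < 3 → twos (d + q * 3) ≡ isTwo d + twos q * 3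
  twos-digit = foldDigits₃-digit 0 (λ d y → isTwo d + y * 3) refl

  digits-+ : ∀ a x b y → (a + x * 3) + (b + y * 3) ≡ (a + b) + (x + y) * 3
  digits-+ = solve-∀

  digits-+2* : ∀ a x b y → (a + x * 3) + 2 * (b + y * 3) ≡ (a + 2 * b) + (x + 2 * y) * 3
  digits-+2* = solve-∀

  dropTwo+2*isTwo : ∀ {d} → d < 3 → dropTwo d + 2 * isTwo d ≡ d
  dropTwo+2*isTwo {0} _ = refl
  dropTwo+2*isTwo {1} _ = refl
  dropTwo+2*isTwo {2} _ = refl
  dropTwo+2*isTwo {suc (suc (suc _))} (s≤s (s≤s (s≤s ())))

  dropTwo<2 : ∀ {d} → d < 3 → dropTwo d < 2
  dropTwo<2 {0} _ = s≤s z≤n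
  dropTwo<2 {1} _ = s≤s (s≤s z≤n)
  dropTwo<2 {2} _ = s≤s z≤n
  dropTwo<2 {suc (suc (suc _))} (s≤s (s≤s (s≤s ())))

  dropTwo+isTwo<2 : ∀ {d} → d < 3 → dropTwo d + isTwo d < 2
  dropTwo+isTwo<2 {0} _ = s≤s z≤n
  dropTwo+isTwo<2 {1} _ = s≤s (s≤s z≤n)
  dropTwo+isTwo<2 {2} _ = s≤s (s≤s z≤n)
  dropTwo+isTwo<2 {suc (suc (suc _))} (s≤s (s≤s (s≤s ())))

  dropTwos+2*twos : ∀ e → dropTwos e + 2 * twos e ≡ e
  dropTwos+2*twos = ternary-ind (λ e → dropTwos e + 2 * twos e ≡ e) refl step
    where
    step : ∀ {d} q → d < 3 → dropTwos q + 2 * twos q ≡ q →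
           dropTwos (d + q * 3) + 2 * twos (d + q * 3) ≡ d + q * 3
    step {d} q d<3 ih = begin
      dropTwos (d + q * 3) + 2 * twos (d + q * 3)
        ≡⟨ cong₂ (λ x y → x + 2 * y) (dropTwos-digit q d<3) (twos-digit q d<3) ⟩
      (dropTwo d + dropTwos q * 3) + 2 * (isTwo d + twos q * 3)
        ≡⟨ digits-+2* (dropTwo d) (dropTwos q) (isTwo d) (twos q) ⟩
      (dropTwo d + 2 * isTwo d) + (dropTwos q + 2 * twos q) * 3
        ≡⟨ cong₂ (λ a x → a + x * 3) (dropTwo+2*isTwo d<3) ih ⟩
      d + q * 3 ∎
      where open ≡-Reasoning

  noDigit2-dropTwos : ∀ e → noDigit2 (dropTwos e) ≡ true
  noDigit2-dropTwos = ternary-ind (λ e → noDigit2 (dropTwos e) ≡ true) refl step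
    where
    step : ∀ {d} q → d < 3 → noDigit2 (dropTwos q) ≡ true → noDigit2 (dropTwos (d + q * 3)) ≡ true
    step {d} q d<3 ih = begin
      noDigit2 (dropTwos (d + q * 3))          ≡⟨ cong noDigit2 (dropTwos-digit q d<3) ⟩
      noDigit2 (dropTwo d + dropTwos q * 3)    ≡⟨ noDigit2-small (dropTwos q) (dropTwo<2 d<3) ⟩
      noDigit2 (dropTwos q)                    ≡⟨ ih ⟩
      true ∎
      where open ≡-Reasoning

  noDigit2-dropTwos+twos : ∀ e → noDigit2 (dropTwos e + twos e) ≡ true
  noDigit2-dropTwos+twos = ternary-ind (λ e → noDigit2 (dropTwos e + twos e) ≡ true) refl step
    where
    step : ∀ {d} q → d < 3 → noDigit2 (dropTwos q + twos q) ≡ true →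
           noDigit2 (dropTwos (d + q * 3) + twos (d + q * 3)) ≡ true
    step {d} q d<3 ih = begin
      noDigit2 (dropTwos (d + q * 3) + twos (d + q * 3))
        ≡⟨ cong noDigit2 (cong₂ _+_ (dropTwos-digit q d<3) (twos-digit q d<3)) ⟩
      noDigit2 ((dropTwo d + dropTwos q * 3) + (isTwo d + twos q * 3))
        ≡⟨ cong noDigit2 (digits-+ (dropTwo d) (dropTwos q) (isTwo d) (twos q)) ⟩
      noDigit2 ((dropTwo d + isTwo d) + (dropTwos q + twos q) * 3)
        ≡⟨ noDigit2-small (dropTwos q + twos q) (dropTwo+isTwo<2 d<3) ⟩
      noDigit2 (dropTwos q + twos q)
        ≡⟨ ih ⟩
      true ∎
      where open ≡-Reasoning

  twos-pos : ∀ e → noDigit2 e ≡ false → 0 < twos e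
  twos-pos e e∉A = n≢0⇒n>0 twos≢0
    where
    twos≢0 : twos e ≢ 0
    twos≢0 eq = true≢false (trans (sym (noDigit2-dropTwos e)) (trans (cong noDigit2 dropTwos≡e) e∉A))
      where
      dropTwos≡e : dropTwos e ≡ e
      dropTwos≡e = trans (sym (trans (cong (λ y → dropTwos e + 2 * y) eq) (+-identityʳ _)))
                         (dropTwos+2*twos e)

  ThreeAP : (ℕ → Bool) → ℕ → ℕ → Set
  ThreeAP A x y = A x ≡ true × A (x + y) ≡ true × A (x + 2 * y) ≡ true

  noDigit2-strip : ∀ {d} q → d < 2 → noDigit2 (d + q * 3) ≡ true → noDigit2 q ≡ true
  noDigit2-strip q d<2 h = trans (sym (noDigit2-small q d<2)) h

  -- If the common difference ends in 0, strip the last digits; otherwise the last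
  -- digits a, a + b, a + 2b of the three terms run through all residues mod 3.
  no3AP-lastDigits : ∀ {a b} x y → a < 3 → b < 3 → 0 < b + y * 3 →
    (0 < y → ¬ ThreeAP noDigit2 x y) → ¬ ThreeAP noDigit2 (a + x * 3) (b + y * 3)
  no3AP-lastDigits {a} {b} x y a<3 b<3 pos ih (h₀ , h₁ , h₂) =
    byDigits a<3 b<3 pos h₀ (trans (cong noDigit2 (sym (digits-+ a x b y))) h₁)
                            (trans (cong noDigit2 (sym (digits-+2* a x b y))) h₂)
    where
    y>0 : 0 < y * 3 → 0 < y
    y>0 3y>0 = n≢0⇒n>0 λ { refl → <⇒≱ 3y>0 z≤n }
    byDigits : ∀ {a b} → a < 3 → b < 3 → 0 < b + y * 3 → noDigit2 (a + x * 3) ≡ true →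
               noDigit2 ((a + b) + (x + y) * 3) ≡ true →
               noDigit2 ((a + 2 * b) + (x + 2 * y) * 3) ≡ true → ⊥
    byDigits {0} {0} _ _ pos h₀ h₁ h₂ = ih (y>0 pos)
      ( noDigit2-strip x (s≤s z≤n) h₀
      , noDigit2-strip (x + y) (s≤s z≤n) h₁
      , noDigit2-strip (x + 2 * y) (s≤s z≤n) h₂ )
    byDigits {1} {0} _ _ pos h₀ h₁ h₂ = ih (y>0 pos)
      ( noDigit2-strip x (s≤s (s≤s z≤n)) h₀
      , noDigit2-strip (x + y) (s≤s (s≤s z≤n)) h₁
      , noDigit2-strip (x + 2 * y) (s≤s (s≤s z≤n)) h₂ )
    byDigits {0} {1} _ _ _ _ _ h₂ = digit2∉noDigit2 (x + 2 * y) h₂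
    byDigits {0} {2} _ _ _ _ h₁ _ = digit2∉noDigit2 (x + y) h₁
    byDigits {1} {1} _ _ _ _ h₁ _ = digit2∉noDigit2 (x + y) h₁
    byDigits {1} {2} _ _ _ _ _ h₂ = digit2∉noDigit2 (suc (x + 2 * y)) h₂
    byDigits {2} _ _ _ h₀ _ _ = digit2∉noDigit2 x h₀
    byDigits {suc (suc (suc _))} (s≤s (s≤s (s≤s ()))) _ _ _ _ _
    byDigits {_} {suc (suc (suc _))} _ (s≤s (s≤s (s≤s ()))) _ _ _ _

  noDigit2-3AP-free : ∀ y → 0 < y → ∀ x → ¬ ThreeAP noDigit2 x y
  noDigit2-3AP-free = ternary-ind (λ y → 0 < y → ∀ x → ¬ ThreeAP noDigit2 x y) (λ ()) step
    where
    step : ∀ {b} y → b < 3 → (0 < y → ∀ x → ¬ ThreeAP noDigit2 x y) →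
           0 < b + y * 3 → ∀ x → ¬ ThreeAP noDigit2 x (b + y * 3)
    step y b<3 ih pos x = subst (λ x → ¬ ThreeAP noDigit2 x _) (sym (m≡m%n+[m/n]*n x 3))
      (no3AP-lastDigits (x / 3) y (m%n<n x 3) b<3 pos (λ y>0 → ih y>0 (x / 3)))

  noDigit2-false⇒2≤ : ∀ {e} → noDigit2 e ≡ false → 2 ≤ e
  noDigit2-false⇒2≤ {0} ()
  noDigit2-false⇒2≤ {1} ()
  noDigit2-false⇒2≤ {suc (suc _)} _ = s≤s (s≤s z≤n)

module Valuation where

  open import Data.Empty using (⊥-elim)
  open import Data.List using ([]; _∷_)
  open import Data.List.Relation.Unary.All using ([]; _∷_)
  open import Data.Nat
  open import Data.Nat.Divisibility
  open import Data.Nat.Primality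
  open import Data.Nat.Primality.Factorisation
  open import Data.Nat.Properties
  open import Data.Nat.Tactic.RingSolver using (solve-∀)
  open import Data.Product using (_×_; _,_; proj₁; proj₂; ∃-syntax)
  open import Data.Sum using (inj₁; inj₂; [_,_]′)
  open import Relation.Binary.PropositionalEquality
  open import Relation.Nullary using (¬_; yes; no)

  ν-fuel : ℕ → ℕ → ℕ → ℕ
  ν-fuel zero    p m = 0
  ν-fuel (suc f) p m with p ∣? m
  ... | yes p∣m = suc (ν-fuel f p (quotient p∣m))
  ... | no  _   = 0

  -- The exponent of p in m, for p > 1 and m > 0 (ν p 0 is a junk value).
  ν : ℕ → ℕ → ℕ
  ν p m = ν-fuel m p m

  ^-monoʳ-∣ : ∀ p {i j} → i ≤ j → p ^ i ∣ p ^ j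
  ^-monoʳ-∣ p {i} {j} i≤j = divides (p ^ (j ∸ i)) (begin
    p ^ j               ≡⟨ cong (p ^_) (sym (m+[n∸m]≡n i≤j)) ⟩
    p ^ (i + (j ∸ i))   ≡⟨ ^-distribˡ-+-* p i (j ∸ i) ⟩
    p ^ i * p ^ (j ∸ i) ≡⟨ *-comm (p ^ i) _ ⟩
    p ^ (j ∸ i) * p ^ i ∎)
    where open ≡-Reasoning

  ^-monoˡ-∣ : ∀ {a b} K → a ∣ b → a ^ K ∣ b ^ K
  ^-monoˡ-∣ zero    a∣b = ∣-refl
  ^-monoˡ-∣ (suc K) a∣b = *-pres-∣ a∣b (^-monoˡ-∣ K a∣b)

  module _ {p : ℕ} .{{_ : NonTrivial p}} where

    private instance
      p≢0 : NonZero p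
      p≢0 = nonTrivial⇒nonZero p

    ν-fuel-spec : ∀ f m → 0 < m → m ≤ f →
                  p ^ ν-fuel f p m ∣ m × ¬ (p ^ suc (ν-fuel f p m) ∣ m)
    ν-fuel-spec (suc f) m@(suc _) _ m≤f with p ∣? m
    ... | no p∤m = 1∣ m , λ p∣m → p∤m (subst (_∣ m) (*-identityʳ p) p∣m)
    ... | yes p∣m = p^[1+v]∣m , p^[2+v]∤m
      where
      q = quotient p∣m
      instance
        q≢0 : NonZero q
        q≢0 = quotient≢0 p∣m
      ih : p ^ ν-fuel f p q ∣ q × ¬ (p ^ suc (ν-fuel f p q) ∣ q)
      ih = ν-fuel-spec f q (>-nonZero⁻¹ q) (≤-pred (≤-trans (quotient-< p∣m) m≤f))
      m≡p*q : m ≡ p * q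
      m≡p*q = m∣n⇒n≡m*quotient p∣m
      p^[1+v]∣m : p ^ suc (ν-fuel f p q) ∣ m
      p^[1+v]∣m = subst (p ^ suc (ν-fuel f p q) ∣_) (sym m≡p*q) (*-monoʳ-∣ p (proj₁ ih))
      p^[2+v]∤m : ¬ (p ^ suc (suc (ν-fuel f p q)) ∣ m)
      p^[2+v]∤m h = proj₂ ih (*-cancelˡ-∣ p (subst (p ^ suc (suc (ν-fuel f p q)) ∣_) m≡p*q h))

    pow-ν∣ : ∀ {m} → 0 < m → p ^ ν p m ∣ m
    pow-ν∣ {m} m>0 = proj₁ (ν-fuel-spec m m m>0 ≤-refl)

    pow-suc-ν∤ : ∀ {m} → 0 < m → ¬ (p ^ suc (ν p m) ∣ m)
    pow-suc-ν∤ {m} m>0 = proj₂ (ν-fuel-spec m m m>0 ≤-refl)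

    ≤ν⇒pow∣ : ∀ {m j} → 0 < m → j ≤ ν p m → p ^ j ∣ m
    ≤ν⇒pow∣ m>0 j≤ν = ∣-trans (^-monoʳ-∣ p j≤ν) (pow-ν∣ m>0)

    pow∣⇒≤ν : ∀ {m j} → 0 < m → p ^ j ∣ m → j ≤ ν p m
    pow∣⇒≤ν {m} {j} m>0 p^j∣m with j ≤? ν p m
    ... | yes j≤ν = j≤ν
    ... | no  j≰ν = ⊥-elim (pow-suc-ν∤ m>0 (∣-trans (^-monoʳ-∣ p (≰⇒> j≰ν)) p^j∣m))

    ν-unique : ∀ {m u} e → m ≡ p ^ e * u → ¬ (p ∣ u) → ν p m ≡ e
    ν-unique {m} {u} e m≡p^e*u p∤u = ≤-antisym ν≤e (pow∣⇒≤ν m>0 (divides u (trans m≡p^e*u (*-comm _ u))))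
      where
      instance
        p^e≢0 : NonZero (p ^ e)
        p^e≢0 = m^n≢0 p e
      m>0 : 0 < m
      m>0 = subst (0 <_) (sym m≡p^e*u)
              (*-mono-≤ (m^n>0 p e) (n≢0⇒n>0 λ { refl → p∤u (p ∣0) }))
      ν≤e : ν p m ≤ e
      ν≤e with ν p m ≤? e
      ... | yes ν≤e = ν≤e
      ... | no  ν≰e = ⊥-elim (p∤u (*-cancelˡ-∣ (p ^ e) (subst₂ _∣_ p^[1+e]≡ m≡p^e*u (≤ν⇒pow∣ m>0 (≰⇒> ν≰e)))))
        where
        p^[1+e]≡ : p ^ suc e ≡ p ^ e * p
        p^[1+e]≡ = *-comm p (p ^ e)

    ∤⇒ν≡0 : ∀ {m} → ¬ (p ∣ m) → ν p m ≡ 0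
    ∤⇒ν≡0 {m} p∤m = ν-unique 0 (sym (*-identityˡ m)) p∤m

    ν-pow : ∀ e → ν p (p ^ e) ≡ e
    ν-pow e = ν-unique e (sym (*-identityʳ (p ^ e))) λ p∣1 → nonTrivial⇒≢1 (∣1⇒≡1 p∣1)

    ∣⇒ν>0 : ∀ {m} → 0 < m → p ∣ m → 0 < ν p m
    ∣⇒ν>0 {m} m>0 p∣m = pow∣⇒≤ν m>0 (subst (_∣ m) (sym (*-identityʳ p)) p∣m)

    ν-decomposition : ∀ {m} → 0 < m → ∃[ u ] (m ≡ p ^ ν p m * u × ¬ (p ∣ u))
    ν-decomposition {m} m>0 with pow-ν∣ m>0
    ... | divides u m≡u*p^ν = u , trans m≡u*p^ν (*-comm u _) , p∤u
      where
      p∤u : ¬ (p ∣ u)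
      p∤u (divides c u≡c*p) = pow-suc-ν∤ m>0 (divides c (begin
        m                   ≡⟨ m≡u*p^ν ⟩
        u * p ^ ν p m       ≡⟨ cong (_* p ^ ν p m) u≡c*p ⟩
        c * p * p ^ ν p m   ≡⟨ *-assoc c p _ ⟩
        c * p ^ suc (ν p m) ∎))
        where open ≡-Reasoning

    pow∤⇒ν< : ∀ {m K} → 0 < m → ¬ (p ^ K ∣ m) → ν p m < K
    pow∤⇒ν< {m} {K} m>0 p^K∤m with ν p m <? K
    ... | yes ν<K = ν<K
    ... | no  ν≮K = ⊥-elim (p^K∤m (≤ν⇒pow∣ m>0 (≮⇒≥ ν≮K)))

    ν-+-multiple : ∀ {m Q K} → 0 < m → p ^ K ∣ Q → ¬ (p ^ K ∣ m) → ν p (m + Q) ≡ ν p m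
    ν-+-multiple {m} {Q} {K} m>0 p^K∣Q p^K∤m = ≤-antisym ν[m+Q]≤ν[m] ν[m]≤ν[m+Q]
      where
      m+Q>0 : 0 < m + Q
      m+Q>0 = ≤-trans m>0 (m≤m+n m Q)
      ν<K : ν p m < K
      ν<K = pow∤⇒ν< m>0 p^K∤m
      ν[m]≤ν[m+Q] : ν p m ≤ ν p (m + Q)
      ν[m]≤ν[m+Q] = pow∣⇒≤ν m+Q>0
        (∣m∣n⇒∣m+n (pow-ν∣ m>0) (∣-trans (^-monoʳ-∣ p (<⇒≤ ν<K)) p^K∣Q))
      ν[m+Q]≤ν[m] : ν p (m + Q) ≤ ν p m
      ν[m+Q]≤ν[m] with ν p (m + Q) ≤? ν p m
      ... | yes ≤ν = ≤ν
      ... | no  ≰ν = ⊥-elim (pow-suc-ν∤ m>0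
        (∣m+n∣m⇒∣n (subst (p ^ suc (ν p m) ∣_) (+-comm m Q) (≤ν⇒pow∣ m+Q>0 (≰⇒> ≰ν)))
                   (∣-trans (^-monoʳ-∣ p ν<K) p^K∣Q)))

  ∃-prime-divisor : ∀ {n} → 1 < n → ∃[ p ] (Prime p × p ∣ n)
  ∃-prime-divisor {suc zero} (s≤s ())
  ∃-prime-divisor {n@(suc (suc _))} _ with factorise n
  ... | record { factors = [] ; isFactorisation = () }
  ... | record { factors = p ∷ _ ; isFactorisation = eq ; factorsPrime = pp ∷ _ } =
    p , pp , subst (p ∣_) (sym eq) (m∣m*n _)

  prime∣pow⇒∣ : ∀ {p q} e → Prime p → p ∣ q ^ e → p ∣ q
  prime∣pow⇒∣ zero    pp p∣1   = ⊥-elim (¬prime[1] (subst Prime (∣1⇒≡1 p∣1) pp))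
  prime∣pow⇒∣ {q = q} (suc e) pp p∣q^[1+e] with euclidsLemma q (q ^ e) pp p∣q^[1+e]
  ... | inj₁ p∣q   = p∣q
  ... | inj₂ p∣q^e = prime∣pow⇒∣ e pp p∣q^e

  module _ {p : ℕ} (pp : Prime p) where

    private instance
      p≢1 : NonTrivial p
      p≢1 = prime⇒nonTrivial pp
      p≢0 : NonZero p
      p≢0 = prime⇒nonZero pp

    ν-* : ∀ {a b} → 0 < a → 0 < b → ν p (a * b) ≡ ν p a + ν p b
    ν-* {a} {b} a>0 b>0 with ν-decomposition a>0 | ν-decomposition b>0
    ... | u , a≡ , p∤u | w , b≡ , p∤w = ν-unique (ν p a + ν p b) ab≡ p∤u*w
      where
      regroup : ∀ x u y w → (x * u) * (y * w) ≡ (x * y) * (u * w)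
      regroup = solve-∀
      ab≡ : a * b ≡ p ^ (ν p a + ν p b) * (u * w)
      ab≡ = begin
        a * b                                 ≡⟨ cong₂ _*_ a≡ b≡ ⟩
        (p ^ ν p a * u) * (p ^ ν p b * w)     ≡⟨ regroup (p ^ ν p a) u (p ^ ν p b) w ⟩
        (p ^ ν p a * p ^ ν p b) * (u * w)     ≡⟨ cong (_* (u * w)) (sym (^-distribˡ-+-* p (ν p a) (ν p b))) ⟩
        p ^ (ν p a + ν p b) * (u * w)         ∎
        where open ≡-Reasoning
      p∤u*w : ¬ (p ∣ u * w)
      p∤u*w p∣uw = [ p∤u , p∤w ]′ (euclidsLemma u w pp p∣uw)

    ν-pow-prime : ∀ {q} e → Prime q → q ≢ p → ν p (q ^ e) ≡ 0
    ν-pow-prime e pq q≢p = ∤⇒ν≡0 λ p∣q^e →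
      [ nonTrivial⇒≢1 , (λ p≡q → q≢p (sym p≡q)) ]′ (prime⇒irreducible pq (prime∣pow⇒∣ e pp p∣q^e))

    ν-1 : ν p 1 ≡ 0
    ν-1 = ν-pow 0

    ν-pow*-self : ∀ {u} k → 0 < u → ν p (p ^ k * u) ≡ k + ν p u
    ν-pow*-self k u>0 = trans (ν-* (m^n>0 p k) u>0) (cong (_+ _) (ν-pow k))

    ν-pow*-other : ∀ {q u} k → Prime q → q ≢ p → 0 < u → ν p (q ^ k * u) ≡ ν p u
    ν-pow*-other {q} k pq q≢p u>0 =
      trans (ν-* (m^n>0 q {{prime⇒nonZero pq}} k) u>0) (cong (_+ _) (ν-pow-prime k pq q≢p))

module Rankin where

  open import Data.Bool using (Bool; true; false)
  open import Data.Empty using (⊥-elim)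
  open import Data.Nat
  open import Data.Nat.Divisibility
  open import Data.Nat.Induction using (<-rec)
  open import Data.Nat.Primality
  open import Data.Nat.Properties
  open import Data.Nat.Tactic.RingSolver using (solve-∀)
  open import Data.Product using (_,_)
  open import Function using (_∘_)
  open import Function.Bundles using (_⇔_; mk⇔; Equivalence)
  open import Relation.Binary.PropositionalEquality
  open import Relation.Nullary using (¬_; yes; no)
  open import Defs using (GPEndingAt; IsGreedyG3)
  open TernaryDigits
  open Valuation

  m<n*m : ∀ {m n} → 0 < m → 1 < n → m < n * m
  m<n*m {m@(suc _)} {n} _ 1<n = subst (m <_) (*-comm m n) (m<m*n m n 1<n)

  ExponentsNoDigit2 : ℕ → Set
  ExponentsNoDigit2 m = ∀ p → Prime p → noDigit2 (ν p m) ≡ true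

  ν-extend : (F : ℕ → ℕ) → F 0 ≡ 0 → ∀ {p m u n} → Prime p → 0 < n →
    m ≡ p ^ ν p m * u → 0 < u → ¬ (p ∣ u) → (∀ q → Prime q → ν q n ≡ F (ν q u)) →
    ∀ q → Prime q → ν q (p ^ F (ν p m) * n) ≡ F (ν q m)
  ν-extend F F0 {p} {m} {u} {n} pp n>0 m≡ u>0 p∤u ν-n q pq with q ≟ p
  ... | yes refl = begin
    ν p (p ^ F (ν p m) * n)   ≡⟨ ν-pow*-self pp (F (ν p m)) n>0 ⟩
    F (ν p m) + ν p n         ≡⟨ cong (F (ν p m) +_) (ν-n p pp) ⟩
    F (ν p m) + F (ν p u)     ≡⟨ cong (λ e → F (ν p m) + F e) (∤⇒ν≡0 {{prime⇒nonTrivial pp}} p∤u) ⟩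
    F (ν p m) + F 0           ≡⟨ cong (F (ν p m) +_) F0 ⟩
    F (ν p m) + 0             ≡⟨ +-identityʳ _ ⟩
    F (ν p m)                 ∎
    where open ≡-Reasoning
  ... | no q≢p = begin
    ν q (p ^ F (ν p m) * n)   ≡⟨ ν-pow*-other pq (F (ν p m)) pp (q≢p ∘ sym) n>0 ⟩
    ν q n                     ≡⟨ ν-n q pq ⟩
    F (ν q u)                 ≡⟨ cong F (sym (ν-pow*-other pq (ν p m) pp (q≢p ∘ sym) u>0)) ⟩
    F (ν q (p ^ ν p m * u))   ≡⟨ cong (F ∘ ν q) (sym m≡) ⟩
    F (ν q m)                 ∎
    where open ≡-Reasoning

  [y+y]+x≡x+2*y : ∀ x y → (y + y) + x ≡ x + 2 * y
  [y+y]+x≡x+2*y = solve-∀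

  ^-square : ∀ p x y → p ^ y * p ^ y * p ^ x ≡ p ^ (x + 2 * y)
  ^-square p x y = begin
    p ^ y * p ^ y * p ^ x   ≡⟨ cong (_* p ^ x) (sym (^-distribˡ-+-* p y y)) ⟩
    p ^ (y + y) * p ^ x     ≡⟨ sym (^-distribˡ-+-* p (y + y) x) ⟩
    p ^ ((y + y) + x)       ≡⟨ cong (p ^_) ([y+y]+x≡x+2*y x y) ⟩
    p ^ (x + 2 * y)         ∎
    where open ≡-Reasoning

  record SquareSplit (X Y : ℕ → ℕ) (m : ℕ) : Set where
    field
      w z     : ℕ
      w>0     : 0 < w
      z>0     : 0 < z
      z*z*w≡m : z * z * w ≡ m
      ν-w     : ∀ p → Prime p → ν p w ≡ X (ν p m)
      ν-z     : ∀ p → Prime p → ν p z ≡ Y (ν p m)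

  squareSplit : (X Y : ℕ → ℕ) → X 0 ≡ 0 → Y 0 ≡ 0 → (∀ e → X e + 2 * Y e ≡ e) →
                ∀ m → 0 < m → SquareSplit X Y m
  squareSplit X Y X0 Y0 X+2Y = <-rec (λ m → 0 < m → SquareSplit X Y m) split
    where
    regroup : ∀ a b c d → (a * c) * (a * c) * (b * d) ≡ (a * a * b) * (c * c * d)
    regroup = solve-∀
    split : ∀ m → (∀ {k} → k < m → 0 < k → SquareSplit X Y k) → 0 < m → SquareSplit X Y m
    split 1 _ _ = record
      { w = 1 ; z = 1 ; w>0 = s≤s z≤n ; z>0 = s≤s z≤n ; z*z*w≡m = refl
      ; ν-w = λ p pp → trans (ν-1 pp) (trans (sym X0) (cong X (sym (ν-1 pp))))
      ; ν-z = λ p pp → trans (ν-1 pp) (trans (sym Y0) (cong Y (sym (ν-1 pp)))) }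
    split m@(suc (suc _)) rec m>0 with ∃-prime-divisor {m} (s≤s (s≤s z≤n))
    ... | p , pp , p∣m with ν-decomposition {{prime⇒nonTrivial pp}} m>0
    ... | u , m≡ , p∤u = record
      { w = p ^ X e * S.w
      ; z = p ^ Y e * S.z
      ; w>0 = *-mono-≤ (m^n>0 p (X e)) S.w>0
      ; z>0 = *-mono-≤ (m^n>0 p (Y e)) S.z>0
      ; z*z*w≡m = begin
          (p ^ Y e * S.z) * (p ^ Y e * S.z) * (p ^ X e * S.w)
            ≡⟨ regroup (p ^ Y e) (p ^ X e) S.z S.w ⟩
          (p ^ Y e * p ^ Y e * p ^ X e) * (S.z * S.z * S.w)
            ≡⟨ cong₂ _*_ (trans (^-square p (X e) (Y e)) (cong (p ^_) (X+2Y e))) S.z*z*w≡m ⟩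
          p ^ e * u
            ≡⟨ sym m≡ ⟩
          m ∎
      ; ν-w = ν-extend X X0 pp S.w>0 m≡ u>0 p∤u S.ν-w
      ; ν-z = ν-extend Y Y0 pp S.z>0 m≡ u>0 p∤u S.ν-z }
      where
      open ≡-Reasoning
      instance
        p≢0 : NonZero p
        p≢0 = prime⇒nonZero pp
      e = ν p m
      u>0 : 0 < u
      u>0 = n≢0⇒n>0 λ { refl → p∤u (p ∣0) }
      u<m : u < m
      u<m = subst (u <_) (sym m≡) (m<n*m u>0
        (^-monoʳ-< p (nonTrivial⇒n>1 p {{prime⇒nonTrivial pp}}) (∣⇒ν>0 {{prime⇒nonTrivial pp}} m>0 p∣m)))
      module S = SquareSplit (rec u<m u>0)

  module _ {g : ℕ → Bool} where

    exponents⇒¬GP : ∀ {m} → (∀ {k} → k < m → 0 < k → g k ≡ true → ExponentsNoDigit2 k) →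
                    ExponentsNoDigit2 m → ¬ GPEndingAt g m
    exponents⇒¬GP {m} inG⇒exps exps (a , r , a>0 , r>1 , r*r*a≡m , g-a , g-ra)
      with ∃-prime-divisor r>1
    ... | p , pp , p∣r = noDigit2-3AP-free (ν p r) ν[r]>0 (ν p a) (A-a , A-ra , A-m)
      where
      r>0 : 0 < r
      r>0 = <-trans (s≤s z≤n) r>1
      ν[r]>0 : 0 < ν p r
      ν[r]>0 = ∣⇒ν>0 {{prime⇒nonTrivial pp}} r>0 p∣r
      ra<m : r * a < m
      ra<m = subst (r * a <_) (trans (sym (*-assoc r r a)) r*r*a≡m) (m<n*m (*-mono-≤ r>0 a>0) r>1)
      a<m : a < m
      a<m = <-trans (m<n*m a>0 r>1) ra<m
      A-a : noDigit2 (ν p a) ≡ true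
      A-a = inG⇒exps a<m a>0 g-a p pp
      A-ra : noDigit2 (ν p a + ν p r) ≡ true
      A-ra = subst (λ e → noDigit2 e ≡ true) (trans (ν-* pp r>0 a>0) (+-comm (ν p r) (ν p a)))
                   (inG⇒exps ra<m (*-mono-≤ r>0 a>0) g-ra p pp)
      ν[m] : ν p m ≡ ν p a + 2 * ν p r
      ν[m] = begin
        ν p m                   ≡⟨ cong (ν p) (sym r*r*a≡m) ⟩
        ν p (r * r * a)         ≡⟨ ν-* pp (*-mono-≤ r>0 r>0) a>0 ⟩
        ν p (r * r) + ν p a     ≡⟨ cong (_+ ν p a) (ν-* pp r>0 r>0) ⟩
        (ν p r + ν p r) + ν p a ≡⟨ [y+y]+x≡x+2*y (ν p a) (ν p r) ⟩
        ν p a + 2 * ν p r       ∎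
        where open ≡-Reasoning
      A-m : noDigit2 (ν p a + 2 * ν p r) ≡ true
      A-m = subst (λ e → noDigit2 e ≡ true) ν[m] (exps p pp)

    -- Write m = z² w with exponents dropTwos and twos of those of m: then w, z w, m
    -- is a progression whose smaller terms have all exponents in A₃*.
    badExponent⇒GP : ∀ {m q} → 0 < m → (∀ {k} → k < m → 0 < k → ExponentsNoDigit2 k → g k ≡ true) →
                     Prime q → noDigit2 (ν q m) ≡ false → GPEndingAt g m
    badExponent⇒GP {m} {q} m>0 exps⇒inG pq bad = w , z , w>0 , z>1 , z*z*w≡m , g-w , g-zw
      where
      open SquareSplit (squareSplit dropTwos twos refl refl dropTwos+2*twos m m>0)
      z>1 : 1 < z
      z>1 = ≤∧≢⇒< z>0 λ 1≡z → <⇒≢ (twos-pos (ν q m) bad)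
              (sym (trans (sym (ν-z q pq)) (trans (cong (ν q) (sym 1≡z)) (ν-1 pq))))
      zw<m : z * w < m
      zw<m = subst (z * w <_) (trans (sym (*-assoc z z w)) z*z*w≡m) (m<n*m (*-mono-≤ z>0 w>0) z>1)
      g-w : g w ≡ true
      g-w = exps⇒inG (<-trans (m<n*m w>0 z>1) zw<m) w>0
              (λ p pp → trans (cong noDigit2 (ν-w p pp)) (noDigit2-dropTwos (ν p m)))
      g-zw : g (z * w) ≡ true
      g-zw = exps⇒inG zw<m (*-mono-≤ z>0 w>0) λ p pp → begin
        noDigit2 (ν p (z * w))                      ≡⟨ cong noDigit2 (ν-* pp z>0 w>0) ⟩
        noDigit2 (ν p z + ν p w)                    ≡⟨ cong noDigit2 (+-comm (ν p z) (ν p w)) ⟩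
        noDigit2 (ν p w + ν p z)                    ≡⟨ cong noDigit2 (cong₂ _+_ (ν-w p pp) (ν-z p pp)) ⟩
        noDigit2 (dropTwos (ν p m) + twos (ν p m))  ≡⟨ noDigit2-dropTwos+twos (ν p m) ⟩
        true                                        ∎
        where open ≡-Reasoning

  rankin : ∀ {g} → IsGreedyG3 g → ∀ m → 0 < m → g m ≡ true ⇔ ExponentsNoDigit2 m
  rankin {g} (_ , greedy) = <-rec (λ m → 0 < m → g m ≡ true ⇔ ExponentsNoDigit2 m) step
    where
    step : ∀ m → (∀ {k} → k < m → 0 < k → g k ≡ true ⇔ ExponentsNoDigit2 k) →
           0 < m → g m ≡ true ⇔ ExponentsNoDigit2 m
    step m rec m>0 = mk⇔ inG⇒exps exps⇒inG
      where
      open Equivalence (greedy m m>0) renaming (to to inG⇒¬GP; from to ¬GP⇒inG)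
      inG⇒exps : g m ≡ true → ExponentsNoDigit2 m
      inG⇒exps g-m p pp with noDigit2 (ν p m) in bad
      ... | true  = refl
      ... | false = ⊥-elim (inG⇒¬GP g-m
        (badExponent⇒GP m>0 (λ k<m k>0 → Equivalence.from (rec k<m k>0)) pp bad))
      exps⇒inG : ExponentsNoDigit2 m → g m ≡ true
      exps⇒inG exps = ¬GP⇒inG (exponents⇒¬GP (λ k<m k>0 → Equivalence.to (rec k<m k>0)) exps)

module WindowSums where

  open import Data.Bool using (Bool; true; false; if_then_else_)
  open import Data.Empty using (⊥-elim)
  open import Data.Nat
  open import Data.Nat.DivMod
  open import Data.Nat.Divisibility
  open import Data.Nat.Properties
  open import Data.Nat.Tactic.RingSolver using (solve-∀)
  open import Function using (_∘_)
  open import Relation.Binary.PropositionalEquality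
  open import Relation.Nullary using (¬_; yes; no)
  open import Relation.Nullary.Decidable using (⌊_⌋)
  open import Defs using (count)

  windowSum : (ℕ → ℕ) → ℕ → ℕ → ℕ
  windowSum f n zero    = 0
  windowSum f n (suc s) = windowSum f n s + f (n + suc s)

  indicator : Bool → ℕ
  indicator b = if b then 1 else 0

  count≡windowSum : ∀ g n s → count g n s ≡ windowSum (indicator ∘ g) n s
  count≡windowSum g n zero    = refl
  count≡windowSum g n (suc s) = cong (_+ indicator (g (n + suc s))) (count≡windowSum g n s)

  windowSum-zero : ∀ n s → windowSum (λ _ → 0) n s ≡ 0
  windowSum-zero n zero    = refl
  windowSum-zero n (suc s) = trans (+-identityʳ _) (windowSum-zero n s)

  windowSum-+ : ∀ f h n s → windowSum (λ m → f m + h m) n s ≡ windowSum f n s + windowSum h n s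
  windowSum-+ f h n zero    = refl
  windowSum-+ f h n (suc s) =
    trans (cong (_+ (f (n + suc s) + h (n + suc s))) (windowSum-+ f h n s))
          (+-exchange (windowSum f n s) (windowSum h n s) _ _)
    where
    +-exchange : ∀ a b c d → (a + b) + (c + d) ≡ (a + c) + (b + d)
    +-exchange = solve-∀

  windowSum-swap : ∀ (H : ℕ → ℕ → ℕ) a t n s →
    windowSum (λ m → windowSum (λ q → H q m) a t) n s ≡ windowSum (λ q → windowSum (H q) n s) a t
  windowSum-swap H a t n zero    = sym (windowSum-zero a t)
  windowSum-swap H a t n (suc s) =
    trans (cong (_+ windowSum (λ q → H q (n + suc s)) a t) (windowSum-swap H a t n s))
          (sym (windowSum-+ (λ q → windowSum (H q) n s) (λ q → H q (n + suc s)) a t))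

  windowSum-mono : ∀ {f h} n s → (∀ m → n < m → m ≤ n + s → f m ≤ h m) →
                   windowSum f n s ≤ windowSum h n s
  windowSum-mono n zero    _   = z≤n
  windowSum-mono n (suc s) f≤h = +-mono-≤
    (windowSum-mono n s λ m n<m m≤n+s → f≤h m n<m (≤-trans m≤n+s (+-monoʳ-≤ n (n≤1+n s))))
    (f≤h (n + suc s) (m<m+n n (s≤s z≤n)) ≤-refl)

  windowSum-++ : ∀ f n s t → windowSum f n (s + t) ≡ windowSum f n s + windowSum f (n + s) t
  windowSum-++ f n s zero    = trans (cong (windowSum f n) (+-identityʳ s)) (sym (+-identityʳ _))
  windowSum-++ f n s (suc t) = begin
    windowSum f n (s + suc t)                                   ≡⟨ cong (windowSum f n) (+-suc s t) ⟩
    windowSum f n (s + t) + f (n + suc (s + t))                 ≡⟨ cong₂ _+_ (windowSum-++ f n s t) (cong f (+-assoc-suc n s t)) ⟩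
    windowSum f n s + windowSum f (n + s) t + f (n + s + suc t) ≡⟨ +-assoc (windowSum f n s) _ _ ⟩
    windowSum f n s + windowSum f (n + s) (suc t)               ∎
    where
    open ≡-Reasoning
    +-assoc-suc : ∀ n s t → n + suc (s + t) ≡ n + s + suc t
    +-assoc-suc = solve-∀

  windowSum-length-mono : ∀ f n {s t} → s ≤ t → windowSum f n s ≤ windowSum f n t
  windowSum-length-mono f n {s} {t} s≤t = begin
    windowSum f n s                                   ≤⟨ m≤m+n _ _ ⟩
    windowSum f n s + windowSum f (n + s) (t ∸ s)     ≡⟨ windowSum-++ f n s (t ∸ s) ⟨
    windowSum f n (s + (t ∸ s))                       ≡⟨ cong (windowSum f n) (m+[n∸m]≡n s≤t) ⟩
    windowSum f n t                                   ∎
    where open ≤-Reasoning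

  windowSum-term : ∀ f n {s} m → n < m → m ≤ n + s → f m ≤ windowSum f n s
  windowSum-term f n {zero}  m n<m m≤n+0 = ⊥-elim (<⇒≱ n<m (≤-trans m≤n+0 (≤-reflexive (+-identityʳ n))))
  windowSum-term f n {suc s} m n<m m≤n+1+s with m ≟ n + suc s
  ... | yes refl = m≤n+m _ _
  ... | no  m≢  = ≤-trans (windowSum-term f n m n<m m≤n+s) (m≤m+n _ _)
    where
    m≤n+s : m ≤ n + s
    m≤n+s = ≤-pred (subst (m <_) (+-suc n s) (≤∧≢⇒< m≤n+1+s m≢))

  windowSum-≤-* : ∀ f n s c B → (∀ m → n < m → m ≤ n + s → c * f m ≤ B) →
                  c * windowSum f n s ≤ s * B
  windowSum-≤-* f n zero    c B _   = ≤-reflexive (*-zeroʳ c)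
  windowSum-≤-* f n (suc s) c B c*f≤B = begin
    c * (windowSum f n s + f (n + suc s))     ≡⟨ *-distribˡ-+ c _ _ ⟩
    c * windowSum f n s + c * f (n + suc s)   ≤⟨ +-mono-≤ (windowSum-≤-* f n s c B earlier) (c*f≤B _ (m<m+n n (s≤s z≤n)) ≤-refl) ⟩
    s * B + B                                 ≡⟨ +-comm (s * B) B ⟩
    suc s * B                                 ∎
    where
    open ≤-Reasoning
    earlier : ∀ m → n < m → m ≤ n + s → c * f m ≤ B
    earlier m n<m m≤n+s = c*f≤B m n<m (≤-trans m≤n+s (+-monoʳ-≤ n (n≤1+n s)))

  Periodic : (ℕ → ℕ) → ℕ → Set
  Periodic f Q = ∀ m → 0 < m → f (m + Q) ≡ f m

  module _ {f : ℕ → ℕ} {Q : ℕ} (periodic : Periodic f Q) where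

    windowSum-shift : ∀ n s → windowSum f (n + Q) s ≡ windowSum f n s
    windowSum-shift n zero    = refl
    windowSum-shift n (suc s) = cong₂ _+_ (windowSum-shift n s)
      (trans (cong f (reorder n Q s)) (periodic (n + suc s) (≤-trans (s≤s z≤n) (m≤n+m (suc s) n))))
      where
      reorder : ∀ n Q s → n + Q + suc s ≡ n + suc s + Q
      reorder = solve-∀

    windowSum-shift-* : ∀ k s → windowSum f (k * Q) s ≡ windowSum f 0 s
    windowSum-shift-* zero    s = refl
    windowSum-shift-* (suc k) s = begin
      windowSum f (Q + k * Q) s ≡⟨ cong (λ n → windowSum f n s) (+-comm Q (k * Q)) ⟩
      windowSum f (k * Q + Q) s ≡⟨ windowSum-shift (k * Q) s ⟩
      windowSum f (k * Q) s     ≡⟨ windowSum-shift-* k s ⟩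
      windowSum f 0 s           ∎
      where open ≡-Reasoning

    windowSum-slide : ∀ n → windowSum f (suc n) Q ≡ windowSum f n Q
    windowSum-slide n = +-cancelˡ-≡ (f (suc n)) _ _ (begin
      f (suc n) + windowSum f (suc n) Q           ≡⟨ cong₂ (λ a b → a + windowSum f b Q) (cong f (+-comm 1 n)) (+-comm 1 n) ⟩
      windowSum f n 1 + windowSum f (n + 1) Q     ≡⟨ windowSum-++ f n 1 Q ⟨
      windowSum f n (1 + Q)                       ≡⟨ cong (windowSum f n) (+-comm 1 Q) ⟩
      windowSum f n (Q + 1)                       ≡⟨ windowSum-++ f n Q 1 ⟩
      windowSum f n Q + f (n + Q + 1)             ≡⟨ cong (λ m → windowSum f n Q + f m) (reorder n Q) ⟩
      windowSum f n Q + f (suc n + Q)             ≡⟨ cong (windowSum f n Q +_) (periodic (suc n) (s≤s z≤n)) ⟩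
      windowSum f n Q + f (suc n)                 ≡⟨ +-comm (windowSum f n Q) _ ⟩
      f (suc n) + windowSum f n Q                 ∎)
      where
      open ≡-Reasoning
      reorder : ∀ n Q → n + Q + 1 ≡ suc n + Q
      reorder = solve-∀

    windowSum-period : ∀ n → windowSum f n Q ≡ windowSum f 0 Q
    windowSum-period zero    = refl
    windowSum-period (suc n) = trans (windowSum-slide n) (windowSum-period n)

    windowSum-periods : ∀ k n → windowSum f n (k * Q) ≡ k * windowSum f 0 Q
    windowSum-periods zero    n = refl
    windowSum-periods (suc k) n = trans (windowSum-++ f n Q (k * Q))
      (cong₂ _+_ (windowSum-period n) (windowSum-periods k (n + Q)))

    periodic-window-upper : 0 < Q → ∀ n s → Q * windowSum f n s ≤ windowSum f 0 Q * (s + Q)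
    periodic-window-upper Q>0 n s = begin
      Q * windowSum f n s               ≤⟨ *-monoʳ-≤ Q (windowSum-length-mono f n s≤) ⟩
      Q * windowSum f n (suc k * Q)     ≡⟨ cong (Q *_) (windowSum-periods (suc k) n) ⟩
      Q * (suc k * c)                   ≡⟨ regroup Q k c ⟩
      c * (k * Q + Q)                   ≤⟨ *-monoʳ-≤ c (+-monoˡ-≤ Q (m/n*n≤m s Q)) ⟩
      c * (s + Q)                       ∎
      where
      open ≤-Reasoning
      instance
        Q≢0 : NonZero Q
        Q≢0 = >-nonZero Q>0
      k = s / Q
      c = windowSum f 0 Q
      s≤ : s ≤ suc k * Q
      s≤ = ≤-trans (≤-reflexive (m≡m%n+[m/n]*n s Q)) (+-monoˡ-≤ (k * Q) (<⇒≤ (m%n<n s Q)))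
      regroup : ∀ Q k c → Q * ((1 + k) * c) ≡ c * (k * Q + Q)
      regroup = solve-∀

    periodic-initial-lower : 0 < Q → ∀ N → N * windowSum f 0 Q ≤ Q * windowSum f 0 N + Q * windowSum f 0 Q
    periodic-initial-lower Q>0 N = begin
      N * c                                ≤⟨ *-monoˡ-≤ c N≤ ⟩
      (k * Q + Q) * c                      ≡⟨ regroup Q k c ⟩
      Q * (k * c) + Q * c                  ≡⟨ cong (λ t → Q * t + Q * c) (windowSum-periods k 0) ⟨
      Q * windowSum f 0 (k * Q) + Q * c    ≤⟨ +-monoˡ-≤ (Q * c) (*-monoʳ-≤ Q (windowSum-length-mono f 0 (m/n*n≤m N Q))) ⟩
      Q * windowSum f 0 N + Q * c          ∎
      where
      open ≤-Reasoning
      instance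
        Q≢0 : NonZero Q
        Q≢0 = >-nonZero Q>0
      k = N / Q
      c = windowSum f 0 Q
      N≤ : N ≤ k * Q + Q
      N≤ = ≤-trans (≤-reflexive (trans (m≡m%n+[m/n]*n N Q) (+-comm (N % Q) (k * Q))))
                   (+-monoʳ-≤ (k * Q) (<⇒≤ (m%n<n N Q)))
      regroup : ∀ Q k c → (k * Q + Q) * c ≡ Q * (k * c) + Q * c
      regroup = solve-∀

    periodic-window-≤ : 0 < Q → ∀ n s N →
      N * windowSum f n s ≤ s * (windowSum f 0 N + windowSum f 0 Q) + N * windowSum f 0 Q
    periodic-window-≤ Q>0 n s N = *-cancelˡ-≤ Q (begin
      Q * (N * windowSum f n s)       ≡⟨ x*[y*z]≡y*[x*z] Q N _ ⟩
      N * (Q * windowSum f n s)       ≤⟨ *-monoʳ-≤ N (periodic-window-upper Q>0 n s) ⟩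
      N * (c * (s + Q))               ≡⟨ regroup₁ N c s Q ⟩
      s * (N * c) + Q * (N * c)       ≤⟨ +-monoˡ-≤ (Q * (N * c)) (*-monoʳ-≤ s (periodic-initial-lower Q>0 N)) ⟩
      s * (Q * F + Q * c) + Q * (N * c) ≡⟨ regroup₂ s Q F c N ⟩
      Q * (s * (F + c) + N * c)       ∎)
      where
      open ≤-Reasoning
      instance
        Q≢0 : NonZero Q
        Q≢0 = >-nonZero Q>0
      c = windowSum f 0 Q
      F = windowSum f 0 N
      x*[y*z]≡y*[x*z] : ∀ x y z → x * (y * z) ≡ y * (x * z)
      x*[y*z]≡y*[x*z] = solve-∀
      regroup₁ : ∀ N c s Q → N * (c * (s + Q)) ≡ s * (N * c) + Q * (N * c)
      regroup₁ = solve-∀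
      regroup₂ : ∀ s Q F c N → s * (Q * F + Q * c) + Q * (N * c) ≡ Q * (s * (F + c) + N * c)
      regroup₂ = solve-∀

  multipleOf : ℕ → ℕ → ℕ
  multipleOf d m = indicator ⌊ d ∣? m ⌋

  multipleOf-≡1 : ∀ {d m} → d ∣ m → multipleOf d m ≡ 1
  multipleOf-≡1 {d} {m} d∣m with d ∣? m
  ... | yes _   = refl
  ... | no  d∤m = ⊥-elim (d∤m d∣m)

  multipleOf-≡0 : ∀ {d m} → ¬ (d ∣ m) → multipleOf d m ≡ 0
  multipleOf-≡0 {d} {m} d∤m with d ∣? m
  ... | yes d∣m = ⊥-elim (d∤m d∣m)
  ... | no  _   = refl

  multipleOf-periodic : ∀ d → Periodic (multipleOf d) d
  multipleOf-periodic d m _ with d ∣? m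
  ... | yes d∣m = multipleOf-≡1 (∣m∣n⇒∣m+n d∣m ∣-refl)
  ... | no  d∤m = multipleOf-≡0 λ d∣m+d → d∤m (∣m+n∣m⇒∣n (subst (d ∣_) (+-comm m d) d∣m+d) ∣-refl)

  windowSum-multipleOf-< : ∀ {d r} → r < d → windowSum (multipleOf d) 0 r ≡ 0
  windowSum-multipleOf-< {d} {r} r<d = n≤0⇒n≡0 (begin
    windowSum (multipleOf d) 0 r   ≤⟨ windowSum-mono 0 r none ⟩
    windowSum (λ _ → 0) 0 r        ≡⟨ windowSum-zero 0 r ⟩
    0                              ∎)
    where
    open ≤-Reasoning
    none : ∀ m → 0 < m → m ≤ r → multipleOf d m ≤ 0
    none m@(suc _) _ m≤r = ≤-reflexive (multipleOf-≡0 λ d∣m → <⇒≱ (≤-<-trans m≤r r<d) (∣⇒≤ d∣m))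

  windowSum-multipleOf-period : ∀ {d} → 0 < d → windowSum (multipleOf d) 0 d ≡ 1
  windowSum-multipleOf-period {suc d} _ =
    cong₂ _+_ (windowSum-multipleOf-< {suc d} ≤-refl) (multipleOf-≡1 {suc d} ∣-refl)

  multiples-≤ : ∀ {d} → 0 < d → ∀ N → d * windowSum (multipleOf d) 0 N ≤ N
  multiples-≤ {d} d>0 N = begin
    d * windowSum (multipleOf d) 0 N                                 ≡⟨ cong (λ t → d * windowSum (multipleOf d) 0 t) N≡ ⟩
    d * windowSum (multipleOf d) 0 (k * d + r)                       ≡⟨ cong (d *_) (windowSum-++ (multipleOf d) 0 (k * d) r) ⟩
    d * (windowSum (multipleOf d) 0 (k * d) + windowSum (multipleOf d) (k * d) r)
      ≡⟨ cong₂ (λ a b → d * (a + b)) full-periods remainder ⟩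
    d * (k + 0)                                                      ≡⟨ cong (d *_) (+-identityʳ k) ⟩
    d * k                                                            ≡⟨ *-comm d k ⟩
    k * d                                                            ≤⟨ m/n*n≤m N d ⟩
    N                                                                ∎
    where
    open ≤-Reasoning
    instance
      d≢0 : NonZero d
      d≢0 = >-nonZero d>0
    k = N / d
    r = N % d
    N≡ : N ≡ k * d + r
    N≡ = trans (m≡m%n+[m/n]*n N d) (+-comm r (k * d))
    full-periods : windowSum (multipleOf d) 0 (k * d) ≡ k
    full-periods = trans (windowSum-periods (multipleOf-periodic d) k 0)
                         (trans (cong (k *_) (windowSum-multipleOf-period d>0)) (*-identityʳ k))
    remainder : windowSum (multipleOf d) (k * d) r ≡ 0
    remainder = trans (windowSum-shift-* (multipleOf-periodic d) k r)
                      (windowSum-multipleOf-< (m%n<n N d))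

  -- Σ_{P < q ≤ P + t} T q ≤ N t / (P (P + t)) when T q ≤ N / q², since
  -- 1 / q² ≤ 1 / (q − 1) − 1 / q telescopes.
  inverseSquare-tail : ∀ {P} → 0 < P → ∀ T N → (∀ q → P < q → q * q * T q ≤ N) →
                       ∀ t → P * windowSum T P t * (P + t) ≤ N * t
  inverseSquare-tail {P} P>0 T N bound zero =
    ≤-reflexive (trans (cong (_* (P + 0)) (*-zeroʳ P)) (sym (*-zeroʳ N)))
  inverseSquare-tail {P} P>0 T N bound (suc t) = *-cancelˡ-≤ (P + t) (begin
    (P + t) * (P * (F + T q) * q)               ≡⟨ regroup₁ P t F (T q) ⟩
    q * (P * F * (P + t)) + P * ((P + t) * q * T q)
      ≤⟨ +-mono-≤ (*-monoʳ-≤ q (inverseSquare-tail P>0 T N bound t)) (*-monoʳ-≤ P last-term) ⟩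
    q * (N * t) + P * N                         ≡⟨ regroup₂ P t N ⟩
    (P + t) * (N * suc t)                       ∎)
    where
    open ≤-Reasoning
    instance
      P+t≢0 : NonZero (P + t)
      P+t≢0 = >-nonZero (≤-trans P>0 (m≤m+n P t))
    F = windowSum T P t
    q = P + suc t
    last-term : (P + t) * q * T q ≤ N
    last-term = ≤-trans (*-monoˡ-≤ (T q) (*-monoˡ-≤ q (+-monoʳ-≤ P (n≤1+n t))))
                        (bound q (≤-trans (s≤s (m≤m+n P t)) (≤-reflexive (sym (+-suc P t)))))
    regroup₁ : ∀ P t F a → (P + t) * (P * (F + a) * (P + (1 + t))) ≡
               (P + (1 + t)) * (P * F * (P + t)) + P * ((P + t) * (P + (1 + t)) * a)
    regroup₁ = solve-∀
    regroup₂ : ∀ P t N → (P + (1 + t)) * (N * t) + P * N ≡ (P + t) * (N * (1 + t))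
    regroup₂ = solve-∀

  indicator≤1 : ∀ b → indicator b ≤ 1
  indicator≤1 true  = ≤-refl
  indicator≤1 false = z≤n

  windowSum-indicator≤ : ∀ (b : ℕ → Bool) n s → windowSum (indicator ∘ b) n s ≤ s
  windowSum-indicator≤ b n zero    = z≤n
  windowSum-indicator≤ b n (suc s) = ≤-trans (+-mono-≤ (windowSum-indicator≤ b n s) (indicator≤1 (b (n + suc s))))
                                             (≤-reflexive (+-comm s 1))

module Sieve where

  open import Data.Bool using (Bool; true; false; _∧_; _∨_; not)
  open import Data.Bool.Properties using (∨-zeroʳ)
  open import Data.Empty using (⊥-elim)
  open import Data.Nat
  open import Data.Nat.Divisibility
  open import Data.Nat.Primality
  open import Data.Nat.Properties
  open import Data.Product using (_×_; _,_; proj₁; proj₂)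
  open import Function using (_∘_)
  open import Function.Bundles using (Equivalence)
  open import Relation.Binary.PropositionalEquality
  open import Relation.Nullary using (¬_; yes; no)
  open import Relation.Nullary.Decidable using (⌊_⌋)
  open import Defs using (IsGreedyG3)
  open TernaryDigits
  open Valuation
  open Rankin
  open WindowSums

  exponentTest : ℕ → ℕ → ℕ → Bool
  exponentTest K p m = not ⌊ prime? p ⌋ ∨ (⌊ p ^ K ∣? m ⌋ ∨ noDigit2 (ν p m))

  exponentTest-pass : ∀ K p m → (Prime p → noDigit2 (ν p m) ≡ true) → exponentTest K p m ≡ true
  exponentTest-pass K p m A-ν with prime? p
  ... | no  _  = refl
  ... | yes pp rewrite A-ν pp = ∨-zeroʳ _

  exponentTest-bad : ∀ K {p m} → exponentTest K p m ≡ true → Prime p →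
                     noDigit2 (ν p m) ≡ false → p ^ K ∣ m
  exponentTest-bad K {p} {m} pass pp bad with prime? p | p ^ K ∣? m
  ... | no ¬pp | _        = ⊥-elim (¬pp pp)
  ... | yes _  | yes p^K∣m = p^K∣m
  ... | yes _  | no _      = ⊥-elim (true≢false (trans (sym pass) bad))

  exponentTest-periodic : ∀ K p {Q m} → p ^ K ∣ Q → 0 < m →
                          exponentTest K p (m + Q) ≡ exponentTest K p m
  exponentTest-periodic K p {Q} {m} p^K∣Q m>0 with prime? p
  ... | no  _  = refl
  ... | yes pp with p ^ K ∣? m | p ^ K ∣? (m + Q)
  ...   | yes _       | yes _       = refl
  ...   | no  p^K∤m   | no  _       =
    cong noDigit2 (ν-+-multiple {{prime⇒nonTrivial pp}} {K = K} m>0 p^K∣Q p^K∤m)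
  ...   | yes p^K∣m   | no  p^K∤m+Q = ⊥-elim (p^K∤m+Q (∣m∣n⇒∣m+n p^K∣m p^K∣Q))
  ...   | no  p^K∤m   | yes p^K∣m+Q =
    ⊥-elim (p^K∤m (∣m+n∣m⇒∣n (subst (p ^ K ∣_) (+-comm m Q) p^K∣m+Q) p^K∣Q))

  ∧-≡true⁻ : ∀ {a b} → a ∧ b ≡ true → a ≡ true × b ≡ true
  ∧-≡true⁻ {true} {true} _ = refl , refl

  sieve : ℕ → ℕ → ℕ → Bool
  sieve K zero    m = true
  sieve K (suc P) m = sieve K P m ∧ exponentTest K (suc P) m

  sieve-intro : ∀ K P m → (∀ p → 0 < p → p ≤ P → exponentTest K p m ≡ true) → sieve K P m ≡ true
  sieve-intro K zero    m _    = refl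
  sieve-intro K (suc P) m pass
    rewrite sieve-intro K P m (λ p p>0 p≤P → pass p p>0 (≤-trans p≤P (n≤1+n P)))
    = pass (suc P) (s≤s z≤n) ≤-refl

  sieve-elim : ∀ K P m → sieve K P m ≡ true → ∀ p → 0 < p → p ≤ P → exponentTest K p m ≡ true
  sieve-elim K zero    m _      p p>0 p≤0 = ⊥-elim (<⇒≱ p>0 p≤0)
  sieve-elim K (suc P) m passes p p>0 p≤1+P with p ≟ suc P
  ... | yes refl  = proj₂ (∧-≡true⁻ passes)
  ... | no  p≢1+P = sieve-elim K P m (proj₁ (∧-≡true⁻ passes)) p p>0 (≤-pred (≤∧≢⇒< p≤1+P p≢1+P))

  sieve-periodic : ∀ K P Q → (∀ p → 0 < p → p ≤ P → p ^ K ∣ Q) →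
                   Periodic (indicator ∘ sieve K P) Q
  sieve-periodic K P Q p^K∣Q m m>0 = cong indicator (sieve-+ P p^K∣Q)
    where
    sieve-+ : ∀ P′ → (∀ p → 0 < p → p ≤ P′ → p ^ K ∣ Q) → sieve K P′ (m + Q) ≡ sieve K P′ m
    sieve-+ zero     _      = refl
    sieve-+ (suc P′) p^K∣Q′ = cong₂ _∧_
      (sieve-+ P′ (λ p p>0 p≤P′ → p^K∣Q′ p p>0 (≤-trans p≤P′ (n≤1+n P′))))
      (exponentTest-periodic K (suc P′) (p^K∣Q′ (suc P′) (s≤s z≤n) ≤-refl) m>0)

  smallPowerDivisors : ℕ → ℕ → ℕ → ℕ
  smallPowerDivisors K P m = windowSum (λ q → multipleOf (q ^ K) m) 1 P

  largeSquareDivisors : ℕ → ℕ → ℕ → ℕ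
  largeSquareDivisors P N m = windowSum (λ q → multipleOf (q * q) m) P N

  divisorErrors : ℕ → ℕ → ℕ → ℕ → ℕ
  divisorErrors K P N m = smallPowerDivisors K P m + largeSquareDivisors P N m

  -- A prime p with ν p m ∉ A₃* that survives the sieve either has p ≤ P, and then
  -- p ^ K ∣ m, or p > P, and then p² ∣ m because 0, 1 ∈ A₃*.
  badExponent⇒divisorError : ∀ K P N {m p} → 0 < m → m ≤ N → sieve K P m ≡ true →
                             Prime p → noDigit2 (ν p m) ≡ false → 0 < divisorErrors K P N m
  badExponent⇒divisorError K P N {m} {p} m>0 m≤N passes pp bad with p ≤? P
  ... | yes p≤P = ≤-trans small>0 (m≤m+n _ _)
    where
    p^K∣m : p ^ K ∣ m
    p^K∣m = exponentTest-bad K (sieve-elim K P m passes p (>-nonZero⁻¹ p {{prime⇒nonZero pp}}) p≤P) pp bad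
    small>0 : 0 < smallPowerDivisors K P m
    small>0 = ≤-trans (≤-reflexive (sym (multipleOf-≡1 p^K∣m)))
                      (windowSum-term (λ q → multipleOf (q ^ K) m) 1 p
                        (nonTrivial⇒n>1 p {{prime⇒nonTrivial pp}}) (≤-trans p≤P (n≤1+n P)))
  ... | no p≰P = ≤-trans large>0 (m≤n+m _ _)
    where
    instance
      m≢0 : NonZero m
      m≢0 = >-nonZero m>0
    p*p∣m : p * p ∣ m
    p*p∣m = subst (_∣ m) (cong (p *_) (*-identityʳ p))
              (≤ν⇒pow∣ {{prime⇒nonTrivial pp}} m>0 (noDigit2-false⇒2≤ bad))
    p≤N : p ≤ N
    p≤N = ≤-trans (∣⇒≤ (∣-trans (m∣m*n p) p*p∣m)) m≤N
    large>0 : 0 < largeSquareDivisors P N m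
    large>0 = ≤-trans (≤-reflexive (sym (multipleOf-≡1 p*p∣m)))
                      (windowSum-term (λ q → multipleOf (q * q) m) P p (≰⇒> p≰P) (≤-trans p≤N (m≤n+m N P)))

  module _ {g : ℕ → Bool} (greedy : IsGreedyG3 g) (K P : ℕ) where

    inG≤sieve : ∀ m → 0 < m → indicator (g m) ≤ indicator (sieve K P m)
    inG≤sieve m m>0 with g m in g-m
    ... | false = z≤n
    ... | true  = ≤-reflexive (cong indicator (sym (sieve-intro K P m λ p _ _ →
        exponentTest-pass K p m λ pp → Equivalence.to (rankin greedy m m>0) g-m p pp)))

    sieve≤inG+errors : ∀ N m → 0 < m → m ≤ N →
                       indicator (sieve K P m) ≤ indicator (g m) + divisorErrors K P N m
    sieve≤inG+errors N m m>0 m≤N with g m in g-m | sieve K P m in passes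
    ... | true  | s     = ≤-trans (indicator≤1 s) (m≤m+n 1 _)
    ... | false | false = z≤n
    ... | false | true with 0 <? divisorErrors K P N m
    ...   | yes errors>0 = errors>0
    ...   | no  errors≯0 = ⊥-elim (true≢false (trans (sym (Equivalence.from (rankin greedy m m>0) exps)) g-m))
      where
      exps : ExponentsNoDigit2 m
      exps p pp with noDigit2 (ν p m) in bad
      ... | true  = refl
      ... | false = ⊥-elim (errors≯0 (badExponent⇒divisorError K P N m>0 m≤N passes pp bad))

    windowSum-inG≤sieve : ∀ n s → windowSum (indicator ∘ g) n s ≤ windowSum (indicator ∘ sieve K P) n s
    windowSum-inG≤sieve n s = windowSum-mono n s λ m n<m _ → inG≤sieve m (≤-trans (s≤s z≤n) n<m)

    windowSum-sieve≤inG+errors : ∀ N → windowSum (indicator ∘ sieve K P) 0 N ≤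
                                 windowSum (indicator ∘ g) 0 N + windowSum (divisorErrors K P N) 0 N
    windowSum-sieve≤inG+errors N =
      ≤-trans (windowSum-mono 0 N (λ m m>0 m≤N → sieve≤inG+errors N m m>0 m≤N))
              (≤-reflexive (windowSum-+ (indicator ∘ g) (divisorErrors K P N) 0 N))

  smallPowerDivisors-total : ∀ K P N → 2 ^ K * windowSum (smallPowerDivisors K P) 0 N ≤ P * N
  smallPowerDivisors-total K P N = begin
    2 ^ K * windowSum (smallPowerDivisors K P) 0 N
      ≡⟨ cong (2 ^ K *_) (windowSum-swap (λ q m → multipleOf (q ^ K) m) 1 P 0 N) ⟩
    2 ^ K * windowSum (λ q → windowSum (multipleOf (q ^ K)) 0 N) 1 P
      ≤⟨ windowSum-≤-* _ 1 P (2 ^ K) N multiples-of-power ⟩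
    P * N ∎
    where
    open ≤-Reasoning
    multiples-of-power : ∀ q → 1 < q → q ≤ 1 + P → 2 ^ K * windowSum (multipleOf (q ^ K)) 0 N ≤ N
    multiples-of-power q q>1 _ =
      ≤-trans (*-monoˡ-≤ _ (^-monoˡ-≤ K q>1))
              (multiples-≤ (m^n>0 q {{>-nonZero (<-trans (s≤s z≤n) q>1)}} K) N)

  largeSquareDivisors-total : ∀ {P} → 0 < P → ∀ N → P * windowSum (largeSquareDivisors P N) 0 N ≤ N
  largeSquareDivisors-total {P} P>0 zero      = ≤-reflexive (*-zeroʳ P)
  largeSquareDivisors-total {P} P>0 N@(suc _) = *-cancelʳ-≤ _ N N (begin
    P * X * N                    ≤⟨ *-monoʳ-≤ (P * X) (m≤n+m N P) ⟩
    P * X * (P + N)              ≡⟨ cong (λ t → P * t * (P + N)) (windowSum-swap (λ q m → multipleOf (q * q) m) P N 0 N) ⟩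
    P * windowSum (λ q → windowSum (multipleOf (q * q)) 0 N) P N * (P + N)
      ≤⟨ inverseSquare-tail P>0 _ N multiples-of-square N ⟩
    N * N                        ∎)
    where
    open ≤-Reasoning
    X = windowSum (largeSquareDivisors P N) 0 N
    multiples-of-square : ∀ q → P < q → q * q * windowSum (multipleOf (q * q)) 0 N ≤ N
    multiples-of-square q P<q = multiples-≤ (*-mono-≤ q>0 q>0) N
      where
      q>0 : 0 < q
      q>0 = ≤-trans (s≤s z≤n) P<q


module DensityBound where

  open import Data.Nat
  open import Data.Nat.Divisibility using (_∣_; ∣-trans; m∣m*n; m≤n⇒m!∣n!)
  open import Data.Nat.Properties
  open import Data.Nat.Tactic.RingSolver using (solve-∀)
  open import Data.Product using (_×_; _,_; ∃-syntax)
  open import Function using (_∘_)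
  open import Relation.Binary.PropositionalEquality
  open import Defs using (IsGreedyG3; count)
  open Valuation using (^-monoˡ-∣)
  open WindowSums
  open Sieve

  n≤2^n : ∀ n → n ≤ 2 ^ n
  n≤2^n zero    = z≤n
  n≤2^n (suc n) = ≤-trans (+-mono-≤ (m^n>0 2 n) (n≤2^n n))
                          (≤-reflexive (cong (2 ^ n +_) (sym (+-identityʳ (2 ^ n)))))

  error-terms≤ : ∀ M s N E c → 8 * (M * E) ≤ 2 * N → 8 * (M * c) ≤ s → 8 * (M * c) ≤ N →
                 s * (M * E) + s * (M * c) + N * (M * c) ≤ s * N
  error-terms≤ M s N E c E≤ c≤s c≤N = *-cancelˡ-≤ 8 (begin
    8 * (s * (M * E) + s * (M * c) + N * (M * c))
      ≡⟨ regroup₁ M s N E c ⟩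
    s * (8 * (M * E)) + s * (8 * (M * c)) + N * (8 * (M * c))
      ≤⟨ +-mono-≤ (+-mono-≤ (*-monoʳ-≤ s E≤) (*-monoʳ-≤ s c≤N)) (*-monoʳ-≤ N c≤s) ⟩
    s * (2 * N) + s * N + N * s
      ≡⟨ regroup₂ s N ⟩
    4 * (s * N)
      ≤⟨ *-monoˡ-≤ (s * N) {4} {8} (s≤s (s≤s (s≤s (s≤s z≤n)))) ⟩
    8 * (s * N) ∎)
    where
    open ≤-Reasoning
    regroup₁ : ∀ M s N E c → 8 * (s * (M * E) + s * (M * c) + N * (M * c)) ≡
               s * (8 * (M * E)) + s * (8 * (M * c)) + N * (8 * (M * c))
    regroup₁ = solve-∀
    regroup₂ : ∀ s N → s * (2 * N) + s * N + N * s ≡ 4 * (s * N)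
    regroup₂ = solve-∀

  -- Used with G, G₀ counts of G₃*, X, F window and initial sums of the sieve, E its
  -- divisor errors and c its mass per period.
  window-estimate : ∀ M s N G X F G₀ E c → G ≤ X → N * X ≤ s * (F + c) + N * c →
    F ≤ G₀ + E → 8 * (M * E) ≤ 2 * N → 8 * (M * c) ≤ s → 8 * (M * c) ≤ N →
    M * N * G ≤ M * s * G₀ + s * N
  window-estimate M s N G X F G₀ E c G≤X X≤ F≤ E≤ c≤s c≤N = begin
    M * N * G                                             ≤⟨ *-monoʳ-≤ (M * N) G≤X ⟩
    M * N * X                                             ≡⟨ *-assoc M N X ⟩
    M * (N * X)                                           ≤⟨ *-monoʳ-≤ M X≤ ⟩
    M * (s * (F + c) + N * c)                             ≤⟨ *-monoʳ-≤ M (+-monoˡ-≤ (N * c) (*-monoʳ-≤ s (+-monoˡ-≤ c F≤))) ⟩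
    M * (s * ((G₀ + E) + c) + N * c)                      ≡⟨ regroup M s N G₀ E c ⟩
    M * s * G₀ + (s * (M * E) + s * (M * c) + N * (M * c)) ≤⟨ +-monoʳ-≤ (M * s * G₀) (error-terms≤ M s N E c E≤ c≤s c≤N) ⟩
    M * s * G₀ + s * N                                    ∎
    where
    open ≤-Reasoning
    regroup : ∀ M s N G₀ E c → M * (s * ((G₀ + E) + c) + N * c) ≡
              M * s * G₀ + (s * (M * E) + s * (M * c) + N * (M * c))
    regroup = solve-∀

  pow∣factorial-pow : ∀ K P p → 0 < p → p ≤ P → p ^ K ∣ (P !) ^ K
  pow∣factorial-pow K P (suc p) _ p≤P = ^-monoˡ-∣ K (∣-trans (m∣m*n (p !)) (m≤n⇒m!∣n! p≤P))

  -- P = 8M bounds the large-square errors by N / 8M, and then K = 8MP bounds the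
  -- small-power errors by P N / 2^K ≤ N / 8M.
  divisorErrors-total : ∀ M → 0 < M → ∀ N →
    8 * (M * windowSum (divisorErrors (8 * M * (8 * M)) (8 * M) N) 0 N) ≤ 2 * N
  divisorErrors-total M M>0 N = begin
    8 * (M * E)                     ≡⟨ cong (λ e → 8 * (M * e)) (windowSum-+ (smallPowerDivisors K P) (largeSquareDivisors P N) 0 N) ⟩
    8 * (M * (E₁ + E₂))             ≡⟨ regroup M E₁ E₂ ⟩
    8 * (M * E₁) + 8 * (M * E₂)     ≤⟨ +-mono-≤ E₁≤ E₂≤ ⟩
    N + N                           ≡⟨ cong (N +_) (sym (+-identityʳ N)) ⟩
    2 * N                           ∎
    where
    open ≤-Reasoning
    P = 8 * M
    K = 8 * M * P
    E₁ = windowSum (smallPowerDivisors K P) 0 N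
    E₂ = windowSum (largeSquareDivisors P N) 0 N
    E = windowSum (divisorErrors K P N) 0 N
    P>0 : 0 < P
    P>0 = *-mono-≤ {1} {8} (s≤s z≤n) M>0
    regroup : ∀ M E₁ E₂ → 8 * (M * (E₁ + E₂)) ≡ 8 * (M * E₁) + 8 * (M * E₂)
    regroup = solve-∀
    E₁≤ : 8 * (M * E₁) ≤ N
    E₁≤ = *-cancelˡ-≤ P {{>-nonZero P>0}} (begin
      P * (8 * (M * E₁))   ≡⟨ P*8M≡K M E₁ ⟩
      K * E₁               ≤⟨ *-monoˡ-≤ E₁ (n≤2^n K) ⟩
      2 ^ K * E₁           ≤⟨ smallPowerDivisors-total K P N ⟩
      P * N                ∎)
      where
      P*8M≡K : ∀ M E₁ → 8 * M * (8 * (M * E₁)) ≡ 8 * M * (8 * M) * E₁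
      P*8M≡K = solve-∀
    E₂≤ : 8 * (M * E₂) ≤ N
    E₂≤ = ≤-trans (≤-reflexive (sym (*-assoc 8 M E₂))) (largeSquareDivisors-total P>0 N)

  window-bound : ∀ {g} → IsGreedyG3 g → ∀ M → 0 < M →
    ∃[ S₀ ] (0 < S₀ × (∀ n s N → S₀ ≤ s → S₀ ≤ N → M * N * count g n s ≤ M * s * count g 0 N + s * N))
  window-bound {g} greedy M M>0 = S₀ , *-mono-≤ (*-mono-≤ {1} {8} (s≤s z≤n) M>0) Q>0 , bound
    where
    P = 8 * M
    K = 8 * M * P
    Q = (P !) ^ K
    S₀ = 8 * M * Q
    Q>0 : 0 < Q
    Q>0 = m^n>0 (P !) {{P !≢0}} K
    f = indicator ∘ sieve K P
    c = windowSum f 0 Q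
    c≤ : ∀ {t} → S₀ ≤ t → 8 * (M * c) ≤ t
    c≤ S₀≤t = ≤-trans (≤-reflexive (sym (*-assoc 8 M c)))
                      (≤-trans (*-monoʳ-≤ (8 * M) (windowSum-indicator≤ (sieve K P) 0 Q)) S₀≤t)
    bound : ∀ n s N → S₀ ≤ s → S₀ ≤ N → M * N * count g n s ≤ M * s * count g 0 N + s * N
    bound n s N S₀≤s S₀≤N = subst₂ (λ G G₀ → M * N * G ≤ M * s * G₀ + s * N)
      (sym (count≡windowSum g n s)) (sym (count≡windowSum g 0 N))
      (window-estimate M s N _ _ _ _ _ c (windowSum-inG≤sieve greedy K P n s)
        (periodic-window-≤ (sieve-periodic K P Q (pow∣factorial-pow K P)) Q>0 n s N)
        (windowSum-sieve≤inG+errors greedy K P N) (divisorErrors-total M M>0 N) (c≤ S₀≤s) (c≤ S₀≤N))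

module Fractions where

  open import Data.Empty using (⊥-elim)
  open import Data.Integer as ℤ using (+_; +[1+_])
  import Data.Integer.Properties as ℤ
  open import Data.Nat as ℕ using (ℕ; zero; suc; _<_; _≤_)
  open import Data.Nat.Coprimality using (Coprime)
  import Data.Nat.Properties as ℕ
  open import Data.Nat.Tactic.RingSolver using (solve-∀)
  open import Data.Product using (_×_; _,_; ∃-syntax)
  open import Data.Rational using (ℚ; mkℚ; _+_; _-_; -_; toℚᵘ) renaming (_≤_ to _≤ℚ_)
  import Data.Rational.Properties as ℚ
  open import Data.Rational.Unnormalised using (mkℚᵘ; *≤*)
    renaming (_+_ to _+ᵘ_; _≤_ to _≤ᵘ_; _≃_ to _≃ᵘ_)
  import Data.Rational.Unnormalised.Properties as ℚᵘ
  open import Relation.Binary.PropositionalEquality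
  open import Defs using (frac)

  frac-≤-+ : ∀ x y s N n d .(c : Coprime (suc n) (suc d)) →
    suc d ℕ.* suc N ℕ.* x ℕ.≤ suc d ℕ.* suc s ℕ.* y ℕ.+ suc s ℕ.* suc N →
    frac x (suc s) ≤ℚ frac y (suc N) + mkℚ +[1+ n ] d c
  frac-≤-+ x y s N n d c h = ℚ.toℚᵘ-cancel-≤
    (ℚᵘ.≤-respˡ-≃ (ℚᵘ.≃-sym (ℚ.toℚᵘ-fromℚᵘ (mkℚᵘ (+ x) s)))
    (ℚᵘ.≤-respʳ-≃ (ℚᵘ.≃-sym sum≃) unnormalised))
    where
    sum≃ : toℚᵘ (frac y (suc N) + mkℚ +[1+ n ] d c) ≃ᵘ mkℚᵘ (+ y) N +ᵘ mkℚᵘ +[1+ n ] d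
    sum≃ = ℚᵘ.≃-trans (ℚ.toℚᵘ-homo-+ (frac y (suc N)) (mkℚ +[1+ n ] d c))
                      (ℚᵘ.+-congˡ (mkℚᵘ +[1+ n ] d) (ℚ.toℚᵘ-fromℚᵘ (mkℚᵘ (+ y) N)))
    regroup₁ : ∀ D N x → x ℕ.* (N ℕ.* D) ≡ D ℕ.* N ℕ.* x
    regroup₁ = solve-∀
    regroup₂ : ∀ D s y n N → D ℕ.* s ℕ.* y ℕ.+ n ℕ.* N ℕ.* s ≡ (y ℕ.* D ℕ.+ n ℕ.* N) ℕ.* s
    regroup₂ = solve-∀
    cross : x ℕ.* (suc N ℕ.* suc d) ℕ.≤ (y ℕ.* suc d ℕ.+ suc n ℕ.* suc N) ℕ.* suc s
    cross = begin
      x ℕ.* (suc N ℕ.* suc d)                              ≡⟨ regroup₁ (suc d) (suc N) x ⟩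
      suc d ℕ.* suc N ℕ.* x                                ≤⟨ h ⟩
      suc d ℕ.* suc s ℕ.* y ℕ.+ suc s ℕ.* suc N            ≤⟨ ℕ.+-monoʳ-≤ (suc d ℕ.* suc s ℕ.* y)
                                                               (ℕ.≤-trans (ℕ.≤-reflexive (ℕ.*-comm (suc s) (suc N)))
                                                                          (ℕ.*-monoˡ-≤ (suc s) (ℕ.m≤n*m (suc N) (suc n)))) ⟩
      suc d ℕ.* suc s ℕ.* y ℕ.+ suc n ℕ.* suc N ℕ.* suc s  ≡⟨ regroup₂ (suc d) (suc s) y (suc n) (suc N) ⟩
      (y ℕ.* suc d ℕ.+ suc n ℕ.* suc N) ℕ.* suc s          ∎
      where open ℕ.≤-Reasoning
    unnormalised : mkℚᵘ (+ x) s ≤ᵘ mkℚᵘ (+ y) N +ᵘ mkℚᵘ +[1+ n ] d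
    unnormalised = *≤* (subst₂ ℤ._≤_ lhs rhs (ℤ.+≤+ cross))
      where
      lhs : + (x ℕ.* (suc N ℕ.* suc d)) ≡ + x ℤ.* + (suc N ℕ.* suc d)
      lhs = ℤ.pos-* x (suc N ℕ.* suc d)
      rhs : + ((y ℕ.* suc d ℕ.+ suc n ℕ.* suc N) ℕ.* suc s) ≡ (+ y ℤ.* + suc d ℤ.+ + suc n ℤ.* + suc N) ℤ.* + suc s
      rhs = trans (ℤ.pos-* (y ℕ.* suc d ℕ.+ suc n ℕ.* suc N) (suc s))
                  (cong (ℤ._* + suc s) (trans (ℤ.pos-+ (y ℕ.* suc d) (suc n ℕ.* suc N))
                                              (cong₂ ℤ._+_ (ℤ.pos-* y (suc d)) (ℤ.pos-* (suc n) (suc N)))))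

  ≤-+⇒-≤ : ∀ p q r → p ≤ℚ q + r → p - r ≤ℚ q
  ≤-+⇒-≤ p q r p≤q+r = subst (p - r ≤ℚ_) q+r-r≡q (ℚ.+-monoˡ-≤ (- r) p≤q+r)
    where
    q+r-r≡q : q + r + - r ≡ q
    q+r-r≡q = trans (ℚ.+-assoc q r (- r)) (trans (cong (λ t → q + t) (ℚ.+-inverseʳ r)) (ℚ.+-identityʳ q))

  -- The lower bound is the upper bound for the window (0, s] with s and N exchanged.
  windowBound⇒uniform : ∀ (C : ℕ → ℕ → ℕ) n d .(c : Coprime (suc n) (suc d)) →
    ∃[ S₀ ] (0 < S₀ × (∀ m s N → S₀ ≤ s → S₀ ≤ N →
      suc d ℕ.* N ℕ.* C m s ℕ.≤ suc d ℕ.* s ℕ.* C 0 N ℕ.+ s ℕ.* N)) →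
    ∃[ S₀ ] ((s N : ℕ) → S₀ ≤ s → S₀ ≤ N →
      ((m : ℕ) → frac (C m s) s ≤ℚ frac (C 0 N) N + mkℚ +[1+ n ] d c)
      × ∃[ m ] (frac (C 0 N) N - mkℚ +[1+ n ] d c ≤ℚ frac (C m s) s))
  windowBound⇒uniform C n d c (S₀ , S₀>0 , bound) = S₀ , λ s N S₀≤s S₀≤N →
    (λ m → window≤ m s N S₀≤s S₀≤N) , 0 , ≤-+⇒-≤ _ _ ε (window≤ 0 N s S₀≤N S₀≤s)
    where
    ε = mkℚ +[1+ n ] d c
    window≤ : ∀ m s N → S₀ ≤ s → S₀ ≤ N → frac (C m s) s ≤ℚ frac (C 0 N) N + ε
    window≤ m s@(suc s′) N@(suc N′) S₀≤s S₀≤N = frac-≤-+ (C m s) (C 0 N) s′ N′ n d c (bound m s N S₀≤s S₀≤N)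
    window≤ m zero    N    S₀≤0 _    = ⊥-elim (ℕ.<⇒≱ S₀>0 S₀≤0)
    window≤ m (suc _) zero _    S₀≤0 = ⊥-elim (ℕ.<⇒≱ S₀>0 S₀≤0)


open import Defs
open import Data.Nat using (ℕ; _≤_)
open import Data.Bool using (Bool)
open import Data.Rational using (ℚ; _+_; _-_; 0ℚ) renaming (_≤_ to _≤ℚ_; _<_ to _<ℚ_)
open import Data.Product using (_×_; ∃-syntax)
open import Data.Nat using (suc; s≤s; z≤n)
open import Data.Integer using (+_; +[1+_]; -[1+_]; +<+)
open import Data.Rational using (mkℚ; *<*)
open DensityBound using (window-bound)
open Fractions using (windowBound⇒uniform)

mainTheorem2 : (g : ℕ → Bool) → IsGreedyG3 g →
    (ε : ℚ) → 0ℚ <ℚ ε →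
      ∃[ S₀ ] ((s N : ℕ) → S₀ ≤ s → S₀ ≤ N →
        ((n : ℕ) → frac (count g n s) s ≤ℚ (frac (count g 0 N) N + ε))
        × (∃[ n ] ((frac (count g 0 N) N - ε) ≤ℚ frac (count g n s) s)))
mainTheorem2 g greedy (mkℚ (+ 0)     d c) (*<* (+<+ ()))
mainTheorem2 g greedy (mkℚ -[1+ n ]  d c) (*<* ())
mainTheorem2 g greedy (mkℚ +[1+ n ] d c) _ =
  windowBound⇒uniform (count g) n d c (window-bound greedy (suc d) (s≤s z≤n))
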